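{- (1) For all $x : B$, if $\texttt{infinite\_dyn}\ x$ holds then for every proof $e : \texttt{eventually\_dyn}\ x$, $\texttt{infinite\_dyn}\ (\texttt{snd}\ (\texttt{pre\_dyn}\ x\ e))$ holds (\texttt{forall x, infinite\_dyn x -> forall e : eventually\_dyn x, infinite\_dyn (snd (pre\_dyn x e))}). (2) For all $t : \texttt{ETrees A1 B1}$ and every proof $i : \texttt{infinite\_t}\ t$, $\texttt{infinite\_t}\ (\texttt{snd}\ (\texttt{pre\_filter\_t}\ t\ (\texttt{infinite\_eventually\_t}\ t\ i)))$ holds.
   Context: Work in Coq. Setting for (1): sets $A, B$; $P : B \to \texttt{bool}$; $h : B \to A$; $g, g' : B \to B$. \texttt{Inductive eventually\_dyn : B -> Prop := | ev\_dyn1 : forall x, P x = true -> eventually\_dyn x | ev\_dyn2 : forall x, P x = false -> eventually\_dyn (g' x) -> eventually\_dyn x.} \texttt{pre\_dyn : forall x, eventually\_dyn x -> A * B} is defined by structural recursion on the proof argument: \texttt{pre\_dyn x d} $= (h\,x, g\,x)$ if $P\,x = \texttt{true}$, and \texttt{pre\_dyn (g' x) d'} if $P\,x = \texttt{false}$, where \texttt{d'} is the structurally smaller sub-proof of \texttt{eventually\_dyn (g' x)} obtained by inversion of \texttt{d}. \texttt{CoInductive infinite\_dyn : B -> Prop := di : forall x (d : eventually\_dyn x), infinite\_dyn (snd (pre\_dyn x d)) -> infinite\_dyn x.} Setting for (2): \texttt{CoInductive ETrees (A B : Set) : Set := | A\_node : A -> ETrees A B -> ETrees A B | B\_node : B ->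 ETrees A B -> ETrees A B -> ETrees A B.} Sets $A_1, B_1, A_2$; predicates $P_A : A_1 \to \texttt{Prop}$, $P_B : B_1 \to \texttt{Prop}$, both decidable; functions $h_1 : A_1 + B_1 \to A_2$, $h_2 : A_1 + B_1 \to A_1 \times B_1$, $h_3 : \texttt{ETrees A1 B1} \to \texttt{ETrees A1 B1}$. \texttt{Inductive eventually\_t : ETrees A1 B1 -> Prop := | ev\_rB : forall x t t1, \textasciitilde P\_B x -> eventually\_t (h3 (B\_node A1 B1 x t t1)) -> eventually\_t (B\_node A1 B1 x t t1) | ev\_bB : forall x t t1, P\_B x -> eventually\_t (B\_node A1 B1 x t t1) | ev\_rA : forall x t, \textasciitilde P\_A x -> eventually\_t (h3 (A\_node A1 B1 x t)) -> eventually\_t (A\_node A1 B1 x t) | ev\_bA : forall x t, P\_A x -> eventually\_t (A\_node A1 B1 x t).} \texttt{pre\_filter\_t : forall t, eventually\_t t -> A2 * ETrees A1 B1} is defined by structural recursion on the proof: for $t = \texttt{A\_node}\ x\ t'$ it returns $(h_1(\texttt{inl}\ x), \texttt{A\_node}\ (\texttt{fst}(h_2(\texttt{inl}\ x)))\ t')$ if $P_A\,x$, otherwise recurses on $h_3(\texttt{A\_node}\ x\ t')$ with the inverted sub-proof; for $t = \texttt{B\_node}\ x\ t'\ t_1$ it returns $(h_1(\texttt{inr}\ x), \texttt{B\_node}\ (\texttt{snd}(h_2(\texttt{inr}\ x)))\ t'\ t_1)$ if $P_B\,x$, otherwise recurses on $h_3(\texttt{B\_node}\ x\ t'\ t_1)$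 with the inverted sub-proof. \texttt{CoInductive infinite\_t : ETrees A1 B1 -> Prop := cf : forall t (e : eventually\_t t), infinite\_t (snd (pre\_filter\_t t e)) -> infinite\_t t.} \texttt{infinite\_eventually\_t : forall t, infinite\_t t -> eventually\_t t} is the proof that extracts, by pattern matching on the constructor \texttt{cf}, the proof of \texttt{eventually\_t t} contained in a proof of \texttt{infinite\_t t}. -}

module Defs where

open import Data.Bool using (Bool; true; false)
open import Data.Product using (_×_; _,_; proj₁; proj₂)
open import Data.Sum using (_⊎_; inj₁; inj₂)
open import Relation.Binary.PropositionalEquality using (_≡_)
open import Relation.Nullary using (¬_)
open import Relation.Unary using (Decidable)

module Dyn {A B : Set} (P : B → Bool) (h : B → A) (g g' : B → B) where

  data eventually-dyn : B → Set where
    ev-dyn1 : ∀ x → P x ≡ true → eventually-dyn x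
    ev-dyn2 : ∀ x → P x ≡ false → eventually-dyn (g' x) → eventually-dyn x

  pre-dyn : ∀ x → eventually-dyn x → A × B
  pre-dyn x (ev-dyn1 .x _) = h x , g x
  pre-dyn x (ev-dyn2 .x _ d') = pre-dyn (g' x) d'

  record infinite-dyn (x : B) : Set where
    coinductive
    constructor di
    field
      ev   : eventually-dyn x
      rest : infinite-dyn (proj₂ (pre-dyn x ev))

mutual
  data ETreesF (A B : Set) : Set where
    A-nodeF : A → ETrees A B → ETreesF A B
    B-nodeF : B → ETrees A B → ETrees A B → ETreesF A B

  record ETrees (A B : Set) : Set where
    coinductive
    constructor fold
    field out : ETreesF A B

open ETrees public

A-node : {A B : Set} → A → ETrees A B → ETrees A B
A-node x t = fold (A-nodeF x t)

B-node : {A B : Set} → B → ETrees A B → ETrees A B → ETrees A B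
B-node x t t1 = fold (B-nodeF x t t1)

module Filter {A1 B1 A2 : Set}
  (PA : A1 → Set) (PB : B1 → Set)
  (decA : Decidable PA) (decB : Decidable PB)
  (h1 : A1 ⊎ B1 → A2) (h2 : A1 ⊎ B1 → A1 × B1)
  (h3 : ETrees A1 B1 → ETrees A1 B1) where

  data eventually-t : ETrees A1 B1 → Set where
    ev-rB : ∀ x t t1 → ¬ PB x → eventually-t (h3 (B-node x t t1)) → eventually-t (B-node x t t1)
    ev-bB : ∀ x t t1 → PB x → eventually-t (B-node x t t1)
    ev-rA : ∀ x t → ¬ PA x → eventually-t (h3 (A-node x t)) → eventually-t (A-node x t)
    ev-bA : ∀ x t → PA x → eventually-t (A-node x t)

  pre-filter-t : ∀ t → eventually-t t → A2 × ETrees A1 B1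
  pre-filter-t .(B-node x t t1) (ev-rB x t t1 _ e) = pre-filter-t (h3 (B-node x t t1)) e
  pre-filter-t .(B-node x t t1) (ev-bB x t t1 _) = h1 (inj₂ x) , B-node (proj₂ (h2 (inj₂ x))) t t1
  pre-filter-t .(A-node x t) (ev-rA x t _ e) = pre-filter-t (h3 (A-node x t)) e
  pre-filter-t .(A-node x t) (ev-bA x t _) = h1 (inj₁ x) , A-node (proj₁ (h2 (inj₁ x))) t

  record infinite-t (t : ETrees A1 B1) : Set where
    coinductive
    constructor cf
    field
      ev   : eventually-t t
      rest : infinite-t (proj₂ (pre-filter-t t ev))

  infinite-eventually-t : ∀ t → infinite-t t → eventually-t t
  infinite-eventually-t t i = infinite-t.ev i

module Submission where

-- (1) A proof of infinite-dyn x carries one particular witness of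
--     eventually-dyn x and asserts that the state reached through it is
--     again infinite.  To transfer this to an arbitrary witness e we show
--     that pre-dyn does not depend on its proof argument: both witnesses
--     follow the same run of g' from x, because at each state P decides
--     which constructor is possible (pre-dyn-irrelevant).  Rewriting along
--     this equality gives part (1).
-- (2) Here the witness is the one stored inside the given proof of
--     infinite-t t, so the claim is exactly its second field.

open import Defs
open import Data.Bool using (Bool; true; false)
open import Data.Product using (_×_; _,_; proj₂)
open import Data.Sum using (_⊎_)
open import Relation.Binary.PropositionalEquality using (_≡_; refl; trans; sym; subst)
open import Relation.Unary using (Decidable)

module DynFacts {A B : Set} (P : B → Bool) (h : B → A) (g g' : B → B) where
  open Dyn P h g g'

  -- The value of pre-dyn is determined by the state alone: two witnesses
  -- of eventually-dyn x cannot disagree on the sign of P at any step.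
  pre-dyn-irrelevant : ∀ x (e e' : eventually-dyn x) → pre-dyn x e ≡ pre-dyn x e'
  pre-dyn-irrelevant x (ev-dyn1 .x _)    (ev-dyn1 .x _)     = refl
  pre-dyn-irrelevant x (ev-dyn1 .x Px≡t) (ev-dyn2 .x Px≡f _) with () ← trans (sym Px≡t) Px≡f
  pre-dyn-irrelevant x (ev-dyn2 .x Px≡f _) (ev-dyn1 .x Px≡t) with () ← trans (sym Px≡t) Px≡f
  pre-dyn-irrelevant x (ev-dyn2 .x _ d)  (ev-dyn2 .x _ d')  = pre-dyn-irrelevant (g' x) d d'

  infinite-dyn-step : ∀ x → infinite-dyn x → ∀ e → infinite-dyn (proj₂ (pre-dyn x e))
  infinite-dyn-step x i e =
    subst (λ r → infinite-dyn (proj₂ r))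
          (pre-dyn-irrelevant x (infinite-dyn.ev i) e)
          (infinite-dyn.rest i)

lemma6p3 : (∀ {A B : Set} (P : B → Bool) (h : B → A) (g g' : B → B) →
    ∀ x → Dyn.infinite-dyn P h g g' x →
    ∀ (e : Dyn.eventually-dyn P h g g' x) →
    Dyn.infinite-dyn P h g g' (proj₂ (Dyn.pre-dyn P h g g' x e)))
    ×
    (∀ {A1 B1 A2 : Set} (PA : A1 → Set) (PB : B1 → Set)
    (decA : Decidable PA) (decB : Decidable PB)
    (h1 : A1 ⊎ B1 → A2) (h2 : A1 ⊎ B1 → A1 × B1)
    (h3 : ETrees A1 B1 → ETrees A1 B1) →
    ∀ t (i : Filter.infinite-t PA PB decA decB h1 h2 h3 t) →
    Filter.infinite-t PA PB decA decB h1 h2 h3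
    (proj₂ (Filter.pre-filter-t PA PB decA decB h1 h2 h3 t
    (Filter.infinite-eventually-t PA PB decA decB h1 h2 h3 t i))))
lemma6p3 =
  (λ P h g g' → DynFacts.infinite-dyn-step P h g g') ,
  (λ PA PB decA decB h1 h2 h3 t i → Filter.infinite-t.rest i)
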